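{- Let $G$ be a finite simple graph and $k$ a positive integer. If $\mathcal{K}$ is a clique with at least $3$ vertices in $\mathcal{B}_k(G)$ and there exists a vertex $a\in V(G)$ such that $P-a=P'-a$ for every pair $P,P'\in\mathcal{K}$, then such a vertex $a$ is unique.
   Context: A stable $k$-partition of $G$ is a multiset $P=\{V_1,\dots,V_k\}$ of $k$ independent sets of $G$ (some possibly empty) that partition $V(G)$. For $v\in V(G)$, $P-v$ denotes the multiset $\{V_i\setminus\{v\}:1\le i\le k\}$. The Bell $k$-coloring graph $\mathcal{B}_k(G)$ has vertex set the stable $k$-partitions of $G$, with distinct $P,Q$ adjacent iff $P-v=Q-v$ for some $v\in V(G)$. -}

module Defs where

open import Data.Nat using (ℕ; _≤_)
open import Data.Fin using (Fin)
open import Data.Fin.Subset using (Subset; _∈_; _-_)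
open import Data.Fin.Permutation using (Permutation′; _⟨$⟩ʳ_)
open import Data.Bool using (Bool; true; false)
open import Data.Product using (Σ; ∃; _×_; _,_)
open import Relation.Binary.PropositionalEquality using (_≡_; _≢_)
open import Relation.Nullary using (¬_)

record Graph (n : ℕ) : Set where
  field
    adj   : Fin n → Fin n → Bool
    sym   : ∀ x y → adj x y ≡ adj y x
    irrefl : ∀ x → adj x x ≡ false

open Graph public

Independent : ∀ {n} → Graph n → Subset n → Set
Independent G S = ∀ x y → x ∈ S → y ∈ S → adj G x y ≡ false

Family : ℕ → ℕ → Set
Family n k = Fin k → Subset n

-- The family is a stable k-partition of G: independent sets partitioning V(G).
-- (Empty members are allowed.)
IsStablePartition : ∀ {n k} → Graph n → Family n k → Set
IsStablePartition G V =
  (∀ i → Independent G (V i)) ×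
  (∀ x → ∃ λ i → x ∈ V i) ×
  (∀ x i j → x ∈ V i → x ∈ V j → i ≡ j)

record StablePartition {n : ℕ} (G : Graph n) (k : ℕ) : Set where
  constructor mkSP
  field
    blocks  : Family n k
    stable  : IsStablePartition G blocks

open StablePartition public

-- Equality of the multisets {V_i : i} and {W_i : i}:
-- there is a permutation σ of the indices with V_i = W_{σ i}.
_≈ₘ_ : ∀ {n k} → Family n k → Family n k → Set
_≈ₘ_ {n} {k} V W = Σ (Permutation′ k) λ σ → ∀ i → V i ≡ W (σ ⟨$⟩ʳ i)

_minus_ : ∀ {n k} → Family n k → Fin n → Family n k
(V minus v) i = V i - v

-- Equality of stable partitions as multisets (vertices of B_k(G)).
_≈P_ : ∀ {n k} {G : Graph n} → StablePartition G k → StablePartition G k → Set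
P ≈P Q = blocks P ≈ₘ blocks Q

SameMinus : ∀ {n k} {G : Graph n} → Fin n → StablePartition G k → StablePartition G k → Set
SameMinus v P Q = (blocks P minus v) ≈ₘ (blocks Q minus v)

BellAdj : ∀ {n k} {G : Graph n} → StablePartition G k → StablePartition G k → Set
BellAdj P Q = ¬ (P ≈P Q) × ∃ λ v → SameMinus v P Q

-- A clique of B_k(G) with m vertices, listed as K 0, ..., K (m-1):
-- pairwise distinct vertices (as multisets) that are pairwise adjacent
-- (adjacency already entails distinctness).
IsClique : ∀ {n k m} {G : Graph n} → (Fin m → StablePartition G k) → Set
IsClique {m = m} K = ∀ (i j : Fin m) → i ≢ j → BellAdj (K i) (K j)

{-# OPTIONS --safe #-}
module Submission where

-- Suppose a ≢ b.  For P, Q in the clique, P - a ≈ Q - a pins down every block of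
-- Q except that of a, and P - b ≈ Q - b pins down a's block except for whether it
-- contains b.  So a clique member is determined by one bit, "is b in a's block?",
-- and by pigeonhole a clique with three members would contain two equal ones.

open import Defs hiding (sym)
open import Data.Nat using (ℕ; _≤_)
open import Data.Nat.Properties using (<⇒≱; ≮⇒≥)
open import Data.Bool using (Bool)
open import Data.Fin using (Fin; _≟_)
open import Data.Fin.Properties using (pigeonhole; <⇒≢; 2↔Bool)
open import Data.Fin.Subset using (Subset; _∈_; _-_; ⁅_⁆)
open import Data.Fin.Subset.Properties using (⊆-antisym; p─q⊆p; x∈p∧x≢y⇒x∈p-y)
open import Data.Fin.Permutation using (Permutation′; _⟨$⟩ʳ_; _∘ₚ_; transpose)
import Data.Fin.Permutation.Components as PC
open import Data.Vec using (lookup)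
open import Data.Vec.Properties using ([]=⇒lookup; lookup⇒[]=)
open import Data.Product using (_,_; proj₁; proj₂)
open import Function using (Inverse; Injection; _∘_)
open import Function.Construct.Symmetry using (↔-sym)
open import Function.Properties.Inverse using (↔⇒↣)
open import Relation.Binary.PropositionalEquality
  using (_≡_; _≢_; refl; sym; trans; cong; subst)
open import Relation.Nullary using (yes; no; contradiction)
open import Relation.Nullary.Decidable using (decidable-stable)

module _ {n : ℕ} where

  minus-≡⇒∈ : ∀ {S T : Subset n} {v x} → S - v ≡ T - v → x ≢ v → x ∈ S → x ∈ T
  minus-≡⇒∈ {T = T} {v} eq x≢v x∈S =
    p─q⊆p T ⁅ v ⁆ (subst (_ ∈_) eq (x∈p∧x≢y⇒x∈p-y x∈S x≢v))

  minus-≡⇒≡ : ∀ {S T : Subset n} {v} → S - v ≡ T - v →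
              (v ∈ S → v ∈ T) → (v ∈ T → v ∈ S) → S ≡ T
  minus-≡⇒≡ {v = v} eq S→T T→S = ⊆-antisym (⊆ eq S→T) (⊆ (sym eq) T→S)
    where
    ⊆ : ∀ {A B} → A - v ≡ B - v → (v ∈ A → v ∈ B) → ∀ {x} → x ∈ A → x ∈ B
    ⊆ A-v≡B-v A→B {x} x∈A with x ≟ v
    ... | yes refl = A→B x∈A
    ... | no x≢v   = minus-≡⇒∈ A-v≡B-v x≢v x∈A

  lookup-≡⇒∈ : ∀ {S T : Subset n} {x} → lookup S x ≡ lookup T x → x ∈ S → x ∈ T
  lookup-≡⇒∈ {T = T} {x} eq x∈S = lookup⇒[]= x T (trans (sym eq) ([]=⇒lookup x∈S))

transpose-respects : ∀ {k} {A : Set} (f : Fin k → A) (i j l : Fin k) →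
                     f i ≡ f j → f (PC.transpose i j l) ≡ f l
transpose-respects f i j l fi≡fj with l ≟ i
... | yes refl = sym fi≡fj
... | no _ with l ≟ j
...   | yes refl = fi≡fj
...   | no _     = refl

transpose-matchˡ : ∀ {k} (i j : Fin k) → PC.transpose i j i ≡ j
transpose-matchˡ i j with i ≟ i
... | yes _  = refl
... | no i≢i = contradiction refl i≢i

module _ {n k : ℕ} {G : Graph n} where

  blockIndex : StablePartition G k → Fin n → Fin k
  blockIndex P x = proj₁ (proj₁ (proj₂ (stable P)) x)

  blockOf : StablePartition G k → Fin n → Subset n
  blockOf P x = blocks P (blockIndex P x)

  ∈-blockOf : (P : StablePartition G k) (x : Fin n) → x ∈ blockOf P x
  ∈-blockOf P x = proj₂ (proj₁ (proj₂ (stable P)) x)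

  blockIndex-unique : (P : StablePartition G k) {x : Fin n} {i : Fin k} →
                      x ∈ blocks P i → i ≡ blockIndex P x
  blockIndex-unique P {x} {i} x∈Pi = proj₂ (proj₂ (stable P)) x i _ x∈Pi (∈-blockOf P x)

  SameMinus⇒blockIndex : ∀ {v x} (P Q : StablePartition G k) ((σ , _) : SameMinus v P Q) →
                         x ≢ v → σ ⟨$⟩ʳ blockIndex P x ≡ blockIndex Q x
  SameMinus⇒blockIndex {x = x} P Q (σ , eq) x≢v =
    blockIndex-unique Q (minus-≡⇒∈ (eq (blockIndex P x)) x≢v (∈-blockOf P x))

  SameMinus⇒blockOf-≡ : ∀ {a b} (P Q : StablePartition G k) → a ≢ b → SameMinus b P Q →
                        (b ∈ blockOf P a → b ∈ blockOf Q a) →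
                        (b ∈ blockOf Q a → b ∈ blockOf P a) →
                        blockOf P a ≡ blockOf Q a
  SameMinus⇒blockOf-≡ {a} {b} P Q a≢b (τ , eq) P→Q Q→P = minus-≡⇒≡ eq′ P→Q Q→P
    where
    eq′ : blockOf P a - b ≡ blockOf Q a - b
    eq′ = trans (eq (blockIndex P a))
                (cong (λ i → blocks Q i - b) (SameMinus⇒blockIndex P Q (τ , eq) a≢b))

  SameMinus-blockOf⇒≈P : ∀ {a} (P Q : StablePartition G k) → SameMinus a P Q →
                         blockOf P a ≡ blockOf Q a → P ≈P Q
  SameMinus-blockOf⇒≈P {a} P Q (σ , eq) Pa≡Qa =
    π , λ i → minus-≡⇒≡ (eq-off-a i) (to i) (from i)
    where
    iP = blockIndex P a
    iQ = blockIndex Q a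
    -- σ may match a's block of P with a block of Q other than a's; both of these
    -- blocks of Q agree with a's block off a, so swapping them repairs σ.
    π : Permutation′ k
    π = σ ∘ₚ transpose (σ ⟨$⟩ʳ iP) iQ
    π-iP : π ⟨$⟩ʳ iP ≡ iQ
    π-iP = transpose-matchˡ (σ ⟨$⟩ʳ iP) iQ
    eq-off-a : ∀ i → blocks P i - a ≡ blocks Q (π ⟨$⟩ʳ i) - a
    eq-off-a i = trans (eq i) (sym (transpose-respects (λ j → blocks Q j - a)
                                      (σ ⟨$⟩ʳ iP) iQ (σ ⟨$⟩ʳ i)
                                      (trans (sym (eq iP)) (cong (_- a) Pa≡Qa))))
    to : ∀ i → a ∈ blocks P i → a ∈ blocks Q (π ⟨$⟩ʳ i)
    to i a∈Pi rewrite blockIndex-unique P a∈Pi | π-iP = ∈-blockOf Q a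
    from : ∀ i → a ∈ blocks Q (π ⟨$⟩ʳ i) → a ∈ blocks P i
    from i a∈Qπi
      rewrite Injection.injective (↔⇒↣ π) (trans (blockIndex-unique Q a∈Qπi) (sym π-iP))
      = ∈-blockOf P a

  SameMinus-twice⇒≈P : ∀ {a b} (P Q : StablePartition G k) → a ≢ b →
                       SameMinus a P Q → SameMinus b P Q →
                       lookup (blockOf P a) b ≡ lookup (blockOf Q a) b → P ≈P Q
  SameMinus-twice⇒≈P P Q a≢b P-a≈Q-a P-b≈Q-b b-agrees = SameMinus-blockOf⇒≈P P Q P-a≈Q-a
    (SameMinus⇒blockOf-≡ P Q a≢b P-b≈Q-b (lookup-≡⇒∈ b-agrees) (lookup-≡⇒∈ (sym b-agrees)))

Bool-classified-clique-size≤2 : ∀ {n k m} {G : Graph n} (K : Fin m → StablePartition G k) →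
                                IsClique K → (f : Fin m → Bool) →
                                (∀ i j → f i ≡ f j → K i ≈P K j) → m ≤ 2
Bool-classified-clique-size≤2 K clique f classifies = ≮⇒≥ λ 2<m →
  let i , j , i<j , fi≡fj = pigeonhole 2<m (Inverse.from 2↔Bool ∘ f)
  in proj₁ (clique i j (<⇒≢ i<j))
           (classifies i j (Injection.injective (↔⇒↣ (↔-sym 2↔Bool)) fi≡fj))

lemma3p2 : ∀ {n : ℕ} (G : Graph n) (k : ℕ) → 1 ≤ k →
    ∀ (m : ℕ) (K : Fin m → StablePartition G k) → IsClique K → 3 ≤ m →
    (a : Fin n) → (∀ i j → SameMinus a (K i) (K j)) →
    (b : Fin n) → (∀ i j → SameMinus b (K i) (K j)) →
    b ≡ a
lemma3p2 G k _ m K clique 3≤m a minus-a b minus-b = decidable-stable (b ≟ a) λ b≢a →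
  <⇒≱ 3≤m (Bool-classified-clique-size≤2 K clique b-with-a
    λ i j → SameMinus-twice⇒≈P (K i) (K j) (b≢a ∘ sym) (minus-a i j) (minus-b i j))
  where
  b-with-a : Fin m → Bool
  b-with-a i = lookup (blockOf (K i) a) b
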